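{- Let $Z=(U,\Omega,\mathcal{C})$ be a $3$-matroid and let $B\in\mathcal{T}(\Omega)$ be a basis of $Z$. Then there is at most one $Y\in\mathrm{Ort}(Z)$ with $Y\cap B=\emptyset$.
   Context: A carrier is $(U,\Omega)$ with $\Omega$ a partition of finite $U$ into skew classes; a skew pair is a 2-subset of a skew class; transversals meet each class in exactly one element, subtransversals are subsets of transversals; $\mathcal T(\Omega)$ is the set of transversals. A semi-multimatroid $Z=(U,\Omega,\mathcal{C})$ has circuits $\mathcal{C}$ (subtransversals) such that each $(T,\mathcal{C}\cap 2^T)$, $T$ a transversal, is a matroid (by circuits); $Z[S]=(S,\mathcal C\cap 2^S)$ for subtransversals $S$. Independent sets are subtransversals containing no circuit; a basis is an inclusion-maximal independent set. A multimatroid: no union of two circuits contains exactly one skew pair; tight: for every subtransversal $S$ with $|S|=|\Omega|-1$ and $\omega$ the class disjoint from $S$, some $x\in\omega$ makes the circuit families of $Z[S\cup\{x\}]$ and $Z[S]$ differ. A $3$-matroid has all skew classes of size 3. For $X\subseteq U$, $Z-X$ has ground set $U\setminus X$, skew classes the nonempty $\omega\setminus X$, and circuits those of $Z$ disjoint from $X$. $\mathrm{Ort}(Z)=\{T\in\mathcal{T}(\Omega):Z-T\text{ is tight}\}$. -}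

module Defs where

open import Data.Nat using (ℕ)
open import Data.Fin using (Fin; _≟_)
open import Data.Fin.Subset using (Subset; _∈_; _∉_; _⊆_; _⊂_; _∪_; _-_; ⁅_⁆; ∣_∣; Nonempty)
open import Data.Vec using (tabulate)
open import Data.Product using (Σ; ∃; _×_)
open import Relation.Nullary using (¬_; ⌊_⌋)
open import Relation.Binary.PropositionalEquality using (_≡_; _≢_)

-- A carrier (U, Ω): U = Fin n, and Ω is given by a class map cls : Fin n → Fin k
-- (the skew class of x is { y | cls y ≡ cls x }).  Circuits are a predicate on subsets.

module _ {n k : ℕ} (cls : Fin n → Fin k) where

  skewClass : Fin k → Subset n
  skewClass j = tabulate (λ x → ⌊ cls x ≟ j ⌋)

  Disjoint : Subset n → Subset n → Set
  Disjoint A B = ∀ x → x ∈ A → x ∉ B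

  IsSubtransversal : Subset n → Set
  IsSubtransversal S = ∀ x y → x ∈ S → y ∈ S → cls x ≡ cls y → x ≡ y

  IsTransversal : Subset n → Set
  IsTransversal T = IsSubtransversal T × (∀ j → ∃ λ x → x ∈ T × cls x ≡ j)

  ExactlyOneSkewPair : Subset n → Set
  ExactlyOneSkewPair X =
    Σ (Fin n) λ x → Σ (Fin n) λ y →
      x ≢ y × x ∈ X × y ∈ X × cls x ≡ cls y ×
      (∀ x' y' → x' ≢ y' → x' ∈ X → y' ∈ X → cls x' ≡ cls y' →
         (x' ≡ x × y' ≡ y) Data.Sum.⊎ (x' ≡ y × y' ≡ x))
    where import Data.Sum

  module _ (𝒞 : Subset n → Set) where

    IsMatroidOn : Subset n → Set
    IsMatroidOn T =
      (∀ C → 𝒞 C → C ⊆ T → Nonempty C) ×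
      (∀ C₁ C₂ → 𝒞 C₁ → 𝒞 C₂ → C₁ ⊆ T → C₂ ⊆ T → ¬ (C₁ ⊂ C₂)) ×
      (∀ C₁ C₂ e → 𝒞 C₁ → 𝒞 C₂ → C₁ ⊆ T → C₂ ⊆ T → C₁ ≢ C₂ →
         e ∈ C₁ → e ∈ C₂ → ∃ λ C₃ → 𝒞 C₃ × C₃ ⊆ ((C₁ ∪ C₂) - e))

    IsSemiMultimatroid : Set
    IsSemiMultimatroid =
      (∀ C → 𝒞 C → IsSubtransversal C) ×
      (∀ T → IsTransversal T → IsMatroidOn T)

    IsMultimatroid : Set
    IsMultimatroid =
      IsSemiMultimatroid ×
      (∀ C₁ C₂ → 𝒞 C₁ → 𝒞 C₂ → ¬ ExactlyOneSkewPair (C₁ ∪ C₂))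

    Is3Matroid : Set
    Is3Matroid = IsMultimatroid × (∀ j → ∣ skewClass j ∣ ≡ 3)

    IsIndependent : Subset n → Set
    IsIndependent I = IsSubtransversal I × (∀ C → 𝒞 C → ¬ (C ⊆ I))

    IsBasis : Subset n → Set
    IsBasis B = IsIndependent B × (∀ J → IsIndependent J → B ⊆ J → J ≡ B)

  -- Tightness of a structure with ground set G ⊆ U (skew classes: the nonempty
  -- ω ∩ G) and circuit predicate 𝒟 (circuits assumed ⊆ G).
  -- For every subtransversal S ⊆ G of size |Ω_G| - 1, i.e. S meets every nonempty
  -- class ω ∩ G except exactly one, ω_j ∩ G, which it is disjoint from: some
  -- x ∈ ω_j ∩ G such that the circuits of Z[S ∪ {x}] differ from those of Z[S],
  -- i.e. some circuit C ⊆ S ∪ {x} with C ⊈ S.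
  IsTightOn : Subset n → (Subset n → Set) → Set
  IsTightOn G 𝒟 =
    ∀ S j → S ⊆ G → IsSubtransversal S →
      (∃ λ z → z ∈ G × cls z ≡ j) →
      (∀ x → x ∈ S → cls x ≢ j) →
      (∀ i → i ≢ j → (∃ λ z → z ∈ G × cls z ≡ i) → ∃ λ x → x ∈ S × cls x ≡ i) →
      ∃ λ x → x ∈ G × cls x ≡ j × ∃ λ C → 𝒟 C × C ⊆ (S ∪ ⁅ x ⁆) × ¬ (C ⊆ S)

  -- Z - X : ground set U \ X, circuits of Z disjoint from X
  minusCircuits : (Subset n → Set) → Subset n → Subset n → Set
  minusCircuits 𝒞 X C = 𝒞 C × Disjoint C X

  InOrt : (Subset n → Set) → Subset n → Set
  InOrt 𝒞 T = IsTransversal T × IsTightOn (Data.Fin.Subset.∁ T) (minusCircuits 𝒞 T)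
    where import Data.Fin.Subset

-- For a basis B and b ∈ B, tightness of Z − Y applied to B − b yields an element x ∉ Y of the
-- skew class of b that closes a circuit with B − b (x ≠ b because B is independent). In a
-- multimatroid this x is unique: two different ones would give two circuits whose union
-- contains exactly the skew pair {x, x′}. So for two candidates Y₁, Y₂ disjoint from B, the
-- class of b contains b, x and the elements of Y₁ and Y₂ there; as classes have size 3, the
-- latter coincide.
module Submission where

open import Defs
open import Data.Nat using (ℕ; _≤_; z≤n; s≤s)
open import Data.Nat.Properties using (≤-<-trans)
open import Data.Fin using (Fin; _≟_)
open import Data.Fin.Subset using (Subset; _∈_; _∉_; _⊆_; _∪_; _─_; _-_; ⁅_⁆; ∣_∣; ∁; inside; outside)
open import Data.Fin.Subset.Properties
  using (_∈?_; ⊆-antisym; p─q⊆p; x∈p∪q⁻; x∈p∪q⁺; x∈⁅x⁆; x∈⁅y⁆⇒x≡y; x∈p∧x≢y⇒x∈p-y;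
         x∈p⇒∣p-x∣<∣p∣; x∈∁p⇒x∉p; x∉p⇒x∈∁p)
open import Data.Vec using (_∷_; here; there)
open import Data.Vec.Properties using (lookup∘tabulate; lookup⇒[]=)
open import Data.Bool.Properties using (T-≡)
open import Data.List using (List; []; _∷_; length)
open import Data.List.Relation.Unary.All using (All; []; _∷_)
open import Data.List.Relation.Unary.AllPairs using ([]; _∷_)
open import Data.List.Relation.Unary.Unique.Propositional using (Unique)
open import Data.Product using (∃; _×_; _,_; proj₁; proj₂)
open import Data.Sum using (_⊎_; inj₁; inj₂)
open import Data.Empty using (⊥; ⊥-elim)
open import Function.Bundles using (Equivalence)
open import Relation.Nullary using (¬_; yes; no)
open import Relation.Nullary.Decidable using (fromWitness)
open import Relation.Binary.PropositionalEquality using (_≡_; _≢_; refl; sym; trans; subst; cong)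

x∈p─q⇒x∉q : ∀ {n} (p q : Subset n) {x} → x ∈ p ─ q → x ∉ q
x∈p─q⇒x∉q (_ ∷ p) (outside ∷ q) (there x∈) (there x∈q) = x∈p─q⇒x∉q p q x∈ x∈q
x∈p─q⇒x∉q (_ ∷ p) (inside  ∷ q) (there x∈) (there x∈q) = x∈p─q⇒x∉q p q x∈ x∈q
x∈p─q⇒x∉q (_ ∷ p) (outside ∷ q) here       ()

x∈p-y⇒x≢y : ∀ {n} {p : Subset n} {x y} → x ∈ p - y → x ≢ y
x∈p-y⇒x≢y {p = p} {y = y} x∈ refl = x∈p─q⇒x∉q p ⁅ y ⁆ x∈ (x∈⁅x⁆ y)

x∈p-y⇒x∈p : ∀ {n} {p : Subset n} {x y} → x ∈ p - y → x ∈ p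
x∈p-y⇒x∈p {p = p} {y = y} = p─q⊆p p ⁅ y ⁆

p⊆q∪⁅x⁆∧p⊈q⇒x∈p : ∀ {n} {p q : Subset n} {x} → p ⊆ q ∪ ⁅ x ⁆ → ¬ (p ⊆ q) → x ∈ p
p⊆q∪⁅x⁆∧p⊈q⇒x∈p {p = p} {q} {x} p⊆q∪x p⊈q with x ∈? p
... | yes x∈p = x∈p
... | no  x∉p = ⊥-elim (p⊈q λ z∈p → inQ z∈p (x∈p∪q⁻ q ⁅ x ⁆ (p⊆q∪x z∈p)))
  where
  inQ : ∀ {z} → z ∈ p → z ∈ q ⊎ z ∈ ⁅ x ⁆ → z ∈ q
  inQ _   (inj₁ z∈q)   = z∈q
  inQ z∈p (inj₂ z∈⁅x⁆) = ⊥-elim (x∉p (subst (_∈ p) (x∈⁅y⁆⇒x≡y x z∈⁅x⁆) z∈p))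

unique⇒length≤∣p∣ : ∀ {n} {p : Subset n} {xs : List (Fin n)} →
  Unique xs → All (_∈ p) xs → length xs ≤ ∣ p ∣
unique⇒length≤∣p∣ []                  []            = z≤n
unique⇒length≤∣p∣ {p = p} (x≢xs ∷ unique-xs) (x∈p ∷ xs∈p) =
  ≤-<-trans (unique⇒length≤∣p∣ unique-xs (removeHead x≢xs xs∈p)) (x∈p⇒∣p-x∣<∣p∣ x∈p)
  where
  removeHead : ∀ {x ys} → All (x ≢_) ys → All (_∈ p) ys → All (_∈ p - x) ys
  removeHead []            []          = []
  removeHead (x≢y ∷ x≢ys) (y∈p ∷ ys∈p) =
    x∈p∧x≢y⇒x∈p-y y∈p (λ y≡x → x≢y (sym y≡x)) ∷ removeHead x≢ys ys∈p

module _ {n k : ℕ} (cls : Fin n → Fin k) where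

  x∈skewClass : ∀ {x j} → cls x ≡ j → x ∈ skewClass cls j
  x∈skewClass {x} {j} clsx≡j = lookup⇒[]= x _
    (trans (lookup∘tabulate _ x) (Equivalence.to T-≡ (fromWitness {a? = cls x ≟ j} clsx≡j)))

  no-four-distinct-in-skewClass : ∀ {j a b c d} → ∣ skewClass cls j ∣ ≡ 3 →
    cls a ≡ j → cls b ≡ j → cls c ≡ j → cls d ≡ j →
    a ≢ b → a ≢ c → a ≢ d → b ≢ c → b ≢ d → c ≢ d → ⊥
  no-four-distinct-in-skewClass size≡3 ca cb cc cd ab ac ad bc bd cd′ with
    subst (4 ≤_) size≡3 (unique⇒length≤∣p∣
      ((ab ∷ ac ∷ ad ∷ []) ∷ (bc ∷ bd ∷ []) ∷ (cd′ ∷ []) ∷ [] ∷ [])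
      (x∈skewClass ca ∷ x∈skewClass cb ∷ x∈skewClass cc ∷ x∈skewClass cd ∷ []))
  ... | s≤s (s≤s (s≤s ()))

  subtransversal-minus-clsDiff : ∀ {B b z} → IsSubtransversal cls B → b ∈ B → z ∈ B - b → cls z ≢ cls b
  subtransversal-minus-clsDiff B-sub b∈B z∈ clsz≡clsb =
    x∈p-y⇒x≢y z∈ (B-sub _ _ (x∈p-y⇒x∈p z∈) b∈B clsz≡clsb)

  module _ (𝒞 : Subset n → Set) where

    ClosesCircuit : Subset n → Fin n → Fin n → Set
    ClosesCircuit B b x = ∃ λ C → 𝒞 C × x ∈ C × C ⊆ (B - b) ∪ ⁅ x ⁆

    closesCircuit-unique : ∀ {B b x x′} → IsMultimatroid cls 𝒞 → IsSubtransversal cls B → b ∈ B →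
      cls x ≡ cls b → cls x′ ≡ cls b → ClosesCircuit B b x → ClosesCircuit B b x′ → x ≡ x′
    closesCircuit-unique {B} {b} {x} {x′} multi B-sub b∈B clsx clsx′
                         (C , C-circ , x∈C , C⊆) (C′ , C′-circ , x′∈C′ , C′⊆) with x ≟ x′
    ... | yes x≡x′ = x≡x′
    ... | no  x≢x′ = ⊥-elim (proj₂ multi C C′ C-circ C′-circ
          (x , x′ , x≢x′ , x∈p∪q⁺ (inj₁ x∈C) , x∈p∪q⁺ (inj₂ x′∈C′) , trans clsx (sym clsx′) ,
           λ u v u≢v u∈ v∈ → onlySkewPair u v u≢v (near u∈) (near v∈)))
      where
      Near : Fin n → Set
      Near z = z ∈ B - b ⊎ (z ≡ x ⊎ z ≡ x′)

      near : ∀ {z} → z ∈ C ∪ C′ → Near z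
      near {z} z∈ with x∈p∪q⁻ C C′ z∈
      ... | inj₁ z∈C with x∈p∪q⁻ (B - b) ⁅ x ⁆ (C⊆ z∈C)
      ...   | inj₁ z∈B-b = inj₁ z∈B-b
      ...   | inj₂ z∈⁅x⁆ = inj₂ (inj₁ (x∈⁅y⁆⇒x≡y x z∈⁅x⁆))
      near {z} z∈ | inj₂ z∈C′ with x∈p∪q⁻ (B - b) ⁅ x′ ⁆ (C′⊆ z∈C′)
      ...   | inj₁ z∈B-b  = inj₁ z∈B-b
      ...   | inj₂ z∈⁅x′⁆ = inj₂ (inj₂ (x∈⁅y⁆⇒x≡y x′ z∈⁅x′⁆))

      offClass : ∀ {z} → z ∈ B - b → cls z ≢ cls b
      offClass = subtransversal-minus-clsDiff B-sub b∈B

      onClass : ∀ {z} → z ≡ x ⊎ z ≡ x′ → cls z ≡ cls b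
      onClass (inj₁ refl) = clsx
      onClass (inj₂ refl) = clsx′

      onlySkewPair : ∀ u v → u ≢ v → Near u → Near v → cls u ≡ cls v →
        (u ≡ x × v ≡ x′) ⊎ (u ≡ x′ × v ≡ x)
      onlySkewPair u v u≢v (inj₁ u∈) (inj₁ v∈) e =
        ⊥-elim (u≢v (B-sub u v (x∈p-y⇒x∈p u∈) (x∈p-y⇒x∈p v∈) e))
      onlySkewPair u v u≢v (inj₁ u∈) (inj₂ v≈) e = ⊥-elim (offClass u∈ (trans e (onClass v≈)))
      onlySkewPair u v u≢v (inj₂ u≈) (inj₁ v∈) e = ⊥-elim (offClass v∈ (trans (sym e) (onClass u≈)))
      onlySkewPair u v u≢v (inj₂ (inj₁ refl)) (inj₂ (inj₂ refl)) e = inj₁ (refl , refl)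
      onlySkewPair u v u≢v (inj₂ (inj₂ refl)) (inj₂ (inj₁ refl)) e = inj₂ (refl , refl)
      onlySkewPair u v u≢v (inj₂ (inj₁ refl)) (inj₂ (inj₁ refl)) e = ⊥-elim (u≢v refl)
      onlySkewPair u v u≢v (inj₂ (inj₂ refl)) (inj₂ (inj₂ refl)) e = ⊥-elim (u≢v refl)

    independent-¬closesCircuit-self : ∀ {B b} → IsIndependent cls 𝒞 B → b ∈ B → ¬ ClosesCircuit B b b
    independent-¬closesCircuit-self {B} {b} B-ind b∈B (C , C-circ , _ , C⊆) =
      proj₂ B-ind C C-circ λ z∈C → inB (x∈p∪q⁻ (B - b) ⁅ b ⁆ (C⊆ z∈C))
      where
      inB : ∀ {z} → z ∈ B - b ⊎ z ∈ ⁅ b ⁆ → z ∈ B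
      inB (inj₁ z∈B-b) = x∈p-y⇒x∈p z∈B-b
      inB (inj₂ z∈⁅b⁆) = subst (_∈ B) (sym (x∈⁅y⁆⇒x≡y b z∈⁅b⁆)) b∈B

    -- Tightness of Z − Y applied to the subtransversal B − b, which misses only the class of b.
    ort-closesCircuit : ∀ {Y B b} → InOrt cls 𝒞 Y → Disjoint cls Y B → IsTransversal cls B → b ∈ B →
      ∃ λ x → x ∉ Y × cls x ≡ cls b × ClosesCircuit B b x
    ort-closesCircuit {Y} {B} {b} (_ , tight) Y∩B≡∅ (B-sub , B-cov) b∈B
      with tight (B - b) (cls b) B-b⊆∁Y B-b-sub (b , ∉Y b∈B , refl) B-b-misses B-b-covers
      where
      ∉Y : ∀ {z} → z ∈ B → z ∈ ∁ Y
      ∉Y z∈B = x∉p⇒x∈∁p λ z∈Y → Y∩B≡∅ _ z∈Y z∈B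

      B-b⊆∁Y : B - b ⊆ ∁ Y
      B-b⊆∁Y z∈ = ∉Y (x∈p-y⇒x∈p z∈)

      B-b-sub : IsSubtransversal cls (B - b)
      B-b-sub u v u∈ v∈ = B-sub u v (x∈p-y⇒x∈p u∈) (x∈p-y⇒x∈p v∈)

      B-b-misses : ∀ z → z ∈ B - b → cls z ≢ cls b
      B-b-misses _ = subtransversal-minus-clsDiff B-sub b∈B

      B-b-covers : ∀ i → i ≢ cls b → (∃ λ z → z ∈ ∁ Y × cls z ≡ i) →
        ∃ λ z → z ∈ B - b × cls z ≡ i
      B-b-covers i i≢clsb _ with B-cov i
      ... | z , z∈B , clsz≡i =
        z , x∈p∧x≢y⇒x∈p-y z∈B (λ z≡b → i≢clsb (trans (sym clsz≡i) (cong cls z≡b))) , clsz≡i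
    ... | x , x∈∁Y , clsx , C , (C-circ , _) , C⊆ , C⊈B-b =
      x , x∈∁p⇒x∉p x∈∁Y , clsx , C , C-circ , p⊆q∪⁅x⁆∧p⊈q⇒x∈p C⊆ C⊈B-b , C⊆

    ort-disjoint-⊆ : ∀ {B Y₁ Y₂} → Is3Matroid cls 𝒞 → IsTransversal cls B → IsIndependent cls 𝒞 B →
      InOrt cls 𝒞 Y₁ → Disjoint cls Y₁ B → InOrt cls 𝒞 Y₂ → Disjoint cls Y₂ B → Y₁ ⊆ Y₂
    ort-disjoint-⊆ {B} {Y₁} {Y₂} (multi , size≡3) B-tr B-ind ort₁ Y₁∩B≡∅ ort₂ Y₂∩B≡∅ {y₁} y₁∈Y₁
      with proj₂ (proj₁ ort₂) (cls y₁) | proj₂ B-tr (cls y₁)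
    ... | y₂ , y₂∈Y₂ , clsy₂ | b , b∈B , clsb
      with y₁ ≟ y₂ | ort-closesCircuit ort₁ Y₁∩B≡∅ B-tr b∈B | ort-closesCircuit ort₂ Y₂∩B≡∅ B-tr b∈B
    ... | yes refl  | _ | _ = y₂∈Y₂
    ... | no  y₁≢y₂ | x , x∉Y₁ , clsx , closes | x′ , x′∉Y₂ , clsx′ , closes′
      with closesCircuit-unique multi (proj₁ B-tr) b∈B clsx clsx′ closes closes′
    ... | refl = ⊥-elim (no-four-distinct-in-skewClass (size≡3 (cls y₁))
          clsb refl clsy₂ (trans clsx clsb)
          (λ b≡y₁ → Y₁∩B≡∅ y₁ y₁∈Y₁ (subst (_∈ B) b≡y₁ b∈B))
          (λ b≡y₂ → Y₂∩B≡∅ y₂ y₂∈Y₂ (subst (_∈ B) b≡y₂ b∈B))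
          (λ b≡x → independent-¬closesCircuit-self B-ind b∈B (subst (ClosesCircuit B b) (sym b≡x) closes))
          y₁≢y₂
          (λ y₁≡x → x∉Y₁ (subst (_∈ Y₁) y₁≡x y₁∈Y₁))
          (λ y₂≡x → x′∉Y₂ (subst (_∈ Y₂) y₂≡x y₂∈Y₂)))

mainTheorem20 : ∀ {n k : ℕ} (cls : Fin n → Fin k) (𝒞 : Subset n → Set) →
    Is3Matroid cls 𝒞 →
    (B : Subset n) → IsTransversal cls B → IsBasis cls 𝒞 B →
    (Y₁ Y₂ : Subset n) →
    InOrt cls 𝒞 Y₁ → Disjoint cls Y₁ B →
    InOrt cls 𝒞 Y₂ → Disjoint cls Y₂ B →
    Y₁ ≡ Y₂
mainTheorem20 cls 𝒞 Z B B-tr (B-ind , _) Y₁ Y₂ ort₁ Y₁∩B≡∅ ort₂ Y₂∩B≡∅ =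
  ⊆-antisym (ort-disjoint-⊆ cls 𝒞 Z B-tr B-ind ort₁ Y₁∩B≡∅ ort₂ Y₂∩B≡∅)
            (ort-disjoint-⊆ cls 𝒞 Z B-tr B-ind ort₂ Y₂∩B≡∅ ort₁ Y₁∩B≡∅)
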